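{- The predecessor map $\mathbf y_{\mathrm{pred}}$ is a section of the successor map viewed as $\mathsf s:\mathbf y_{\mathbf N}\to (n:\mathbf y_{\mathbf N})\times(n\neq 0)$; that is, internally, $\mathsf s(\mathbf y_{\mathrm{pred}}(n))=n$ for every $n:\mathbf y_{\mathbf N}$ with $n\neq 0$. This holds both in $\mathrm{PSh}(\mathrm{R})$ and in $\mathcal R$.
   Context: $\mathrm{R}$ has objects $\mathbf 1$ (terminal) and $\mathbf N$, $\mathrm{R}(\mathbf N,\mathbf N)$ = primitive recursive functions $\mathbb N\to\mathbb N$, $\mathrm{R}(\mathbf 1,\mathbf N)=\mathbb N$; $\mathcal R=\mathrm{Sh}(\mathrm{R},\mathrm{J}_{\mathrm{fin}})$ with $\mathrm{J}_{\mathrm{fin}}$ generated by finite jointly surjective families (a subcanonical topology). $\mathbf y_{\mathbf N}$ is the representable, with $0$ and successor $\mathsf s$ induced by $0\in\mathbb N$ and the successor function; $\mathbf y_{\mathrm{pred}}:\mathbf y_{\mathbf N}\to\mathbf y_{\mathbf N}$ is induced by the primitive recursive predecessor function ($\mathrm{pred}(0)=0$, $\mathrm{pred}(n+1)=n$). -}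

module Defs where

open import Data.Nat using (ℕ; zero; suc) renaming (pred to ℕpred)
open import Data.Fin using (Fin) renaming (zero to fz; suc to fs)
open import Data.Vec using (Vec; []; _∷_; lookup)
open import Data.Unit using (⊤; tt)
open import Data.Empty using (⊥)
open import Data.Product using (Σ; _,_; proj₁; proj₂)
open import Data.List using (List)
open import Data.List.Relation.Unary.Any using (Any)
open import Data.List.Relation.Unary.All using (All)
open import Relation.Binary.PropositionalEquality using (_≡_; refl; cong; sym; trans)

data PR : ℕ → Set where
  zeroᵖ   : ∀ {n} → PR n
  sucᵖ   : PR 1
  projᵖ   : ∀ {n} → Fin n → PR n
  compᵖ   : ∀ {n m} → PR m → Vec (PR n) m → PR n
  Rec : ∀ {n} → PR n → PR (suc (suc n)) → PR (suc n)

mutual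
  eval : ∀ {n} → PR n → Vec ℕ n → ℕ
  eval zeroᵖ xs = 0
  eval sucᵖ (x ∷ []) = suc x
  eval (projᵖ i) xs = lookup xs i
  eval (compᵖ f gs) xs = eval f (evalV gs xs)
  eval (Rec g h) (k ∷ xs) = evalRec g h k xs

  evalV : ∀ {n m} → Vec (PR n) m → Vec ℕ n → Vec ℕ m
  evalV [] xs = []
  evalV (g ∷ gs) xs = eval g xs ∷ evalV gs xs

  evalRec : ∀ {n} → PR n → PR (suc (suc n)) → ℕ → Vec ℕ n → ℕ
  evalRec g h zero xs = eval g xs
  evalRec g h (suc k) xs = eval h (k ∷ evalRec g h k xs ∷ xs)

IsPR : (ℕ → ℕ) → Set
IsPR f = Σ (PR 1) λ c → ∀ x → eval c (x ∷ []) ≡ f x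

constPR : ℕ → PR 1
constPR zero = zeroᵖ
constPR (suc m) = compᵖ sucᵖ (constPR m ∷ [])

constPR-ok : ∀ m x → eval (constPR m) (x ∷ []) ≡ m
constPR-ok zero x = refl
constPR-ok (suc m) x = cong suc (constPR-ok m x)

-- The category R: objects 1 and N; morphisms are functions between the
-- underlying sets (⊤ and ℕ), those N → N being primitive recursive.

data Obj : Set where
  one : Obj
  N   : Obj

⟦_⟧ : Obj → Set
⟦ one ⟧ = ⊤
⟦ N ⟧ = ℕ

IsMor : (X Y : Obj) → (⟦ X ⟧ → ⟦ Y ⟧) → Set
IsMor N N f = IsPR f
IsMor _ _ f = ⊤

Hom : Obj → Obj → Set
Hom X Y = Σ (⟦ X ⟧ → ⟦ Y ⟧) (IsMor X Y)

_≈_ : ∀ {X Y} → Hom X Y → Hom X Y → Set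
f ≈ g = ∀ x → proj₁ f x ≡ proj₁ g x

idR : ∀ {X} → Hom X X
idR {one} = (λ x → x) , tt
idR {N} = (λ x → x) , (projᵖ fz , λ x → refl)

comp-ok : ∀ X Y W (g : ⟦ Y ⟧ → ⟦ W ⟧) (f : ⟦ X ⟧ → ⟦ Y ⟧) →
          IsMor Y W g → IsMor X Y f → IsMor X W (λ x → g (f x))
comp-ok one Y one g f _ _ = tt
comp-ok one Y N g f _ _ = tt
comp-ok N Y one g f _ _ = tt
comp-ok N one N g f _ _ = constPR (g tt) , λ x → constPR-ok (g tt) x
comp-ok N N N g f (cg , pg) (cf , pf) =
  compᵖ cg (cf ∷ []) , λ x → trans (cong (λ y → eval cg (y ∷ [])) (pf x)) (pg (f x))

infixr 9 _∘_
_∘_ : ∀ {X Y W} → Hom Y W → Hom X Y → Hom X W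
_∘_ {X} {Y} {W} (g , mg) (f , mf) = (λ x → g (f x)) , comp-ok X Y W g f mg mf

! : ∀ {X} → Hom X one
! = (λ _ → tt) , ok
  where
  ok : ∀ {X} → IsMor X one (λ _ → tt)
  ok {one} = tt
  ok {N} = tt

zeroR : Hom one N
zeroR = (λ _ → 0) , tt

sR : Hom N N
sR = suc , (sucᵖ , λ x → refl)

predCode : PR 1
predCode = Rec zeroᵖ (projᵖ fz)

predCode-ok : ∀ x → eval predCode (x ∷ []) ≡ ℕpred x
predCode-ok zero = refl
predCode-ok (suc x) = refl

-- y_pred (on representables, postcomposition with this morphism)
predR : Hom N N
predR = ℕpred , (predCode , predCode-ok)

record Sieve (X : Obj) : Set₁ where
  field
    mem    : ∀ {Y} → Hom Y X → Set
    resp   : ∀ {Y} {f g : Hom Y X} → f ≈ g → mem f → mem g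
    closed : ∀ {Y W} (f : Hom Y X) (h : Hom W Y) → mem f → mem (f ∘ h)
open Sieve public

emptySieve : ∀ {X} → Sieve X
emptySieve = record { mem = λ _ → ⊥ ; resp = λ _ () ; closed = λ _ _ () }

eqSieve : ∀ {X Y} → Hom X Y → Hom X Y → Sieve X
eqSieve a b = record
  { mem = λ g → (a ∘ g) ≈ (b ∘ g)
  ; resp = λ {_} {f} {g} f≈g e w →
      trans (cong (proj₁ a) (sym (f≈g w))) (trans (e w) (cong (proj₁ b) (f≈g w)))
  ; closed = λ f h e w → e (proj₁ h w) }

pullback : ∀ {X Y} → Sieve X → Hom Y X → Sieve Y
pullback S f = record
  { mem = λ h → mem S (f ∘ h)
  ; resp = λ {_} {h} {h'} h≈h' m → resp S (λ w → cong (proj₁ f) (h≈h' w)) m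
  ; closed = λ h k m → resp S (λ w → refl) (closed S (f ∘ h) k m) }

Coverage : Set₂
Coverage = (X : Obj) → Sieve X → Set₁

-- trivial topology (presheaves): only sieves containing the identity cover
data PShCovers (X : Obj) (S : Sieve X) : Set₁ where
  maximal : mem S (idR {X}) → PShCovers X S

Family : Obj → Set
Family X = List (Σ Obj λ Y → Hom Y X)

JointlySurjective : ∀ {X} → Family X → Set
JointlySurjective {X} fam =
  (p : Hom one X) → Any (λ Yf → Σ (Hom one (proj₁ Yf)) λ q → (proj₂ Yf ∘ q) ≈ p) fam

-- J_fin: the Grothendieck topology generated by finite jointly surjective
-- families (inductively: generating sieves, upward closure, stability
-- under pullback, local character)
data JfinCovers : (X : Obj) → Sieve X → Set₁ where
  generator : ∀ {X} (fam : Family X) → JointlySurjective fam →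
              (S : Sieve X) → All (λ Yf → mem S (proj₂ Yf)) fam →
              JfinCovers X S
  upward    : ∀ {X} (S T : Sieve X) → JfinCovers X S →
              (∀ {Y} (f : Hom Y X) → mem S f → mem T f) → JfinCovers X T
  stable    : ∀ {X Y} (S : Sieve X) → JfinCovers X S → (g : Hom Y X) →
              JfinCovers Y (pullback S g)
  local     : ∀ {X} (R S : Sieve X) → JfinCovers X R →
              (∀ {Y} (f : Hom Y X) → mem R f → JfinCovers Y (pullback S f)) →
              JfinCovers X S

-- Internal language (fragment) over the object y_N, with Kripke–Joyal
-- forcing in Sh(R, J) for a topology J (J trivial gives PSh(R)).

data Term (n : ℕ) : Set where
  var  : Fin n → Term n
  zer  : Term n
  succ : Term n → Term n
  prd  : Term n → Term n

data Formula (n : ℕ) : Set where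
  falsum : Formula n
  _≐_    : Term n → Term n → Formula n
  _⇒_    : Formula n → Formula n → Formula n
  all    : Formula (suc n) → Formula n

¬' : ∀ {n} → Formula n → Formula n
¬' φ = φ ⇒ falsum

-- generalised elements of y_N at stage X are morphisms X → N (Yoneda)
Env : Obj → ℕ → Set
Env X n = Fin n → Hom X N

extend : ∀ {X n} → Hom X N → Env X n → Env X (suc n)
extend a ρ fz = a
extend a ρ (fs i) = ρ i

restrict : ∀ {X Y n} → Env X n → Hom Y X → Env Y n
restrict ρ f i = ρ i ∘ f

⟦_⟧t : ∀ {X n} → Term n → Env X n → Hom X N
⟦ var i ⟧t ρ = ρ i
⟦ zer ⟧t ρ = zeroR ∘ !
⟦ succ t ⟧t ρ = sR ∘ ⟦ t ⟧t ρ
⟦ prd t ⟧t ρ = predR ∘ ⟦ t ⟧t ρ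

Forces : Coverage → (X : Obj) → ∀ {n} → Formula n → Env X n → Set₁
Forces J X falsum ρ = J X emptySieve
Forces J X (t ≐ u) ρ = J X (eqSieve (⟦ t ⟧t ρ) (⟦ u ⟧t ρ))
Forces J X (φ ⇒ ψ) ρ =
  ∀ Y (f : Hom Y X) → Forces J Y φ (restrict ρ f) → Forces J Y ψ (restrict ρ f)
Forces J X (all φ) ρ =
  ∀ Y (f : Hom Y X) (a : Hom Y N) → Forces J Y φ (extend a (restrict ρ f))

Valid : Coverage → Formula 0 → Set₁
Valid J φ = Forces J one φ (λ ())

predSection : Formula 0
predSection = all (¬' (var fz ≐ zer) ⇒ (succ (prd (var fz)) ≐ var fz))

{-# OPTIONS --safe #-}
-- Both topologies have two properties: maximal sieves cover, and every
-- covering sieve contains every global point (for J_fin because generating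
-- families are jointly surjective on points, and the closure rules preserve
-- this). If ¬(n = 0) is forced at stage X, then restricting to a point x
-- with n(x) = 0 would force ⊥ at 1, i.e. make the empty sieve cover 1; so
-- n(x) ≠ 0 at every point, s(pred n) = n holds pointwise, and the equaliser
-- sieve of s ∘ pred ∘ n and n is maximal.
module Submission where

open import Defs
open import Data.Product using (_×_; _,_; proj₁)
open import Data.Nat using (suc; ≢-nonZero)
open import Data.Nat.Properties using (suc-pred)
open import Data.Fin using () renaming (zero to fz)
open import Data.Unit using (tt)
open import Data.List using ([]; _∷_)
open import Data.List.Relation.Unary.Any using (here)
open import Data.List.Relation.Unary.All using ([]; _∷_; lookupAny)
open import Relation.Binary.PropositionalEquality using (_≢_; refl)

point : ∀ {X} → ⟦ X ⟧ → Hom one X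
point x = (λ _ → x) , tt

∘-identityˡ : ∀ {X Y} (f : Hom Y X) → (idR ∘ f) ≈ f
∘-identityˡ {one} f y = refl
∘-identityˡ {N} f y = refl

eqSieve-idR : ∀ {X Y} {a b : Hom X Y} → a ≈ b → mem (eqSieve a b) idR
eqSieve-idR {one} a≈b = a≈b
eqSieve-idR {N} a≈b = a≈b

MaximalSievesCover : Coverage → Set₁
MaximalSievesCover J = ∀ {X} (S : Sieve X) → mem S idR → J X S

CoversContainPoints : Coverage → Set₁
CoversContainPoints J = ∀ {X} (S : Sieve X) → J X S → ∀ x → mem S (point x)

PSh-maximalSievesCover : MaximalSievesCover PShCovers
PSh-maximalSievesCover S = maximal

PSh-coversContainPoints : CoversContainPoints PShCovers
PSh-coversContainPoints S (maximal id∈S) x =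
  resp S (∘-identityˡ (point x)) (closed S idR (point x) id∈S)

Jfin-maximalSievesCover : MaximalSievesCover JfinCovers
Jfin-maximalSievesCover {X} S id∈S =
  generator ((X , idR) ∷ []) idR-surjective S (id∈S ∷ [])
  where
  idR-surjective : JointlySurjective ((X , idR) ∷ [])
  idR-surjective p = here (p , ∘-identityˡ p)

Jfin-coversContainPoints : CoversContainPoints JfinCovers
Jfin-coversContainPoints S (generator fam surj .S fam⊆S) x
  with lookupAny fam⊆S (surj (point x))
... | f∈S , (q , f∘q≈x) = resp S f∘q≈x (closed S _ q f∈S)
Jfin-coversContainPoints T (upward S .T S-covers S⊆T) x =
  S⊆T (point x) (Jfin-coversContainPoints S S-covers x)
Jfin-coversContainPoints .(pullback S g) (stable S S-covers g) x =
  Jfin-coversContainPoints S S-covers (proj₁ g x)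
Jfin-coversContainPoints S (local R .S R-covers S-locally) x =
  Jfin-coversContainPoints (pullback S (point x))
    (S-locally (point x) (Jfin-coversContainPoints R R-covers x)) tt

module _ {J : Coverage}
         (maximalSievesCover : MaximalSievesCover J)
         (coversContainPoints : CoversContainPoints J) where

  equaliser-covers : ∀ {X} (a b : Hom X N) → a ≈ b → J X (eqSieve a b)
  equaliser-covers a b a≈b =
    maximalSievesCover (eqSieve a b) (eqSieve-idR {a = a} {b} a≈b)

  forced-nonzero : ∀ {X n} (ρ : Env X (suc n)) →
                   Forces J X (¬' (var fz ≐ zer)) ρ → ∀ x → proj₁ (ρ fz) x ≢ 0
  forced-nonzero ρ ≠0 x ρx≡0 =
    coversContainPoints emptySieve
      (≠0 one (point x)
        (equaliser-covers (ρ fz ∘ point x) (zeroR ∘ !) (λ _ → ρx≡0)))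
      tt

  predSection-valid : Valid J predSection
  predSection-valid Y f a Z g ≠0 =
    equaliser-covers (sR ∘ predR ∘ n) n λ z →
      suc-pred _ {{≢-nonZero (forced-nonzero ρ ≠0 z)}}
    where
    ρ : Env Z 1
    ρ = restrict (extend a (restrict (λ ()) f)) g
    n : Hom Z N
    n = ρ fz

mainTheorem14 : Valid PShCovers predSection × Valid JfinCovers predSection
mainTheorem14 =
    predSection-valid PSh-maximalSievesCover PSh-coversContainPoints
  , predSection-valid Jfin-maximalSievesCover Jfin-coversContainPoints
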